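{- Let $G,H$ be incidence hypergraphs and let $[G,H]_V$ and $\mathrm{vev}_H^G:G\check\Box[G,H]_V\to H$ be as in the context. For every incidence hypergraph $K$ and every homomorphism $\phi:G\check\Box K\to H$ there is a unique homomorphism $\hat\phi:K\to[G,H]_V$ such that $\mathrm{vev}_H^G\circ(G\check\Box\hat\phi)=\phi$.
   Context: An incidence hypergraph $G$ consists of sets $\check V(G),\check E(G),I(G)$ and functions $\varsigma_G:I(G)\to\check V(G)$, $\omega_G:I(G)\to\check E(G)$; a homomorphism is a triple $(\check V\phi,\check E\phi,I\phi)$ with $\varsigma_H\circ I\phi=\check V\phi\circ\varsigma_G$ and $\omega_H\circ I\phi=\check E\phi\circ\omega_G$; $\mathfrak R(G,H)$ is the set of homomorphisms. Incidence box product: $\check V(G\check\Box H)=\check V(G)\times\check V(H)$, $\check E(G\check\Box H)=(\{1\}\times\check E(G)\times\check V(H))\cup(\{2\}\times\check V(G)\times\check E(H))$, $I(G\check\Box H)=(\{1\}\times I(G)\times\check V(H))\cup(\{2\}\times\check V(G)\times I(H))$, $\varsigma(1,x,y)=(\varsigma_Gx,y)$, $\varsigma(2,x,y)=(x,\varsigma_Hy)$, $\omega(1,x,y)=(1,\omega_Gx,y)$, $\omega(2,x,y)=(2,x,\omega_Hy)$; for $\phi,\psi$: $(v,w)\mapsto(\check V\phi(v),\check V\psi(w))$, $(1,x,y)\mapsto(1,\check E\phi(x),\check V\psi(y))$ and $(2,x,y)\mapsto(2,\check V\phi(x),\check E\psi(y))$ on edges, $(1,x,y)\mapsto(1,I\phi(x),\check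 V\psi(y))$ and $(2,x,y)\mapsto(2,\check V\phi(x),I\psi(y))$ on incidences. $\check V^\diamond(\{1\})$: one vertex $1$ only; $I^\diamond(\{1\})$: one vertex $1$, one edge $1$, one incidence $1$ joining them; $Y(y):\check V^\diamond(\{1\})\to I^\diamond(\{1\})$ the inclusion of the vertex. $\check r_G:G\check\Box\check V^\diamond(\{1\})\to G$ is the isomorphism $(v,1)\mapsto v$, $(1,e,1)\mapsto e$, $(1,i,1)\mapsto i$. Box exponential $[G,H]_V$: vertices $\mathfrak R(G,H)$; edges the set of all functions $\check V(G)\to\check E(H)$; incidences $\mathfrak R(G\check\Box I^\diamond(\{1\}),H)$; $\varsigma(\psi)=\psi\circ(G\check\Box Y(y))\circ\check r_G^{ -1}$; $\omega(\psi)$ is the function $v\mapsto\check E(\psi)(2,v,1)$. Evaluation $\mathrm{vev}$: $\check V(\mathrm{vev})(v,\phi)=\check V(\phi)(v)$; $\check E(\mathrm{vev})(1,x,\phi)=\check E(\phi)(x)$ for $\phi\in\mathfrak R(G,H)$; $\check E(\mathrm{vev})(2,x,f)=f(x)$ for $f:\check V(G)\to\check E(H)$; $I(\mathrm{vev})(1,x,\phi)=I(\phi)(x)$; $I(\mathrm{vev})(2,x,\varphi)=I(\varphi)(2,x,1)$. -}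

module Defs where

open import Level using (Level; suc; _⊔_)
open import Data.Product using (_×_; _,_)
open import Data.Sum using (_⊎_; inj₁; inj₂)
open import Data.Unit.Polymorphic using (⊤; tt)
open import Data.Empty.Polymorphic using (⊥)
open import Relation.Binary.PropositionalEquality using (_≡_; refl; cong; trans)

record Hypergraph (ℓ : Level) : Set (suc ℓ) where
  field
    V : Set ℓ
    E : Set ℓ
    I : Set ℓ
    ς : I → V
    ω : I → E
open Hypergraph public

-- Homomorphism: triple of maps commuting with ς and ω (the commutation
-- proofs are fields; Agda's default axiom K makes them proof-irrelevant up to ≡).
record Hom {ℓ : Level} (G H : Hypergraph ℓ) : Set ℓ where
  constructor hom
  field
    Vφ : V G → V H
    Eφ : E G → E H
    Iφ : I G → I H
    ς-comm : ∀ i → ς H (Iφ i) ≡ Vφ (ς G i)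
    ω-comm : ∀ i → ω H (Iφ i) ≡ Eφ (ω G i)
open Hom public

_∘ₕ_ : ∀ {ℓ} {G H K : Hypergraph ℓ} → Hom H K → Hom G H → Hom G K
hom vψ eψ iψ sψ oψ ∘ₕ hom vφ eφ iφ sφ oφ = hom (λ v → vψ (vφ v)) (λ e → eψ (eφ e)) (λ i → iψ (iφ i))
  (λ i → trans (sψ (iφ i)) (cong vψ (sφ i)))
  (λ i → trans (oψ (iφ i)) (cong eψ (oφ i)))

-- Incidence box product.  Tag 1 ↦ inj₁, tag 2 ↦ inj₂.
_□_ : ∀ {ℓ} → Hypergraph ℓ → Hypergraph ℓ → Hypergraph ℓ
G □ H = record
  { V = V G × V H
  ; E = (E G × V H) ⊎ (V G × E H)
  ; I = (I G × V H) ⊎ (V G × I H)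
  ; ς = λ { (inj₁ (x , y)) → (ς G x , y) ; (inj₂ (x , y)) → (x , ς H y) }
  ; ω = λ { (inj₁ (x , y)) → inj₁ (ω G x , y) ; (inj₂ (x , y)) → inj₂ (x , ω H y) }
  }

_□ₕ_ : ∀ {ℓ} {G G' H H' : Hypergraph ℓ} → Hom G G' → Hom H H' → Hom (G □ H) (G' □ H')
hom vφ eφ iφ sφ oφ □ₕ hom vψ eψ iψ sψ oψ = hom
  (λ { (v , w) → (vφ v , vψ w) })
  (λ { (inj₁ (x , y)) → inj₁ (eφ x , vψ y) ; (inj₂ (x , y)) → inj₂ (vφ x , eψ y) })
  (λ { (inj₁ (x , y)) → inj₁ (iφ x , vψ y) ; (inj₂ (x , y)) → inj₂ (vφ x , iψ y) })
  (λ { (inj₁ (x , y)) → cong (λ a → (a , vψ y)) (sφ x)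
     ; (inj₂ (x , y)) → cong (λ b → (vφ x , b)) (sψ y) })
  (λ { (inj₁ (x , y)) → cong (λ a → inj₁ (a , vψ y)) (oφ x)
     ; (inj₂ (x , y)) → cong (λ b → inj₂ (vφ x , b)) (oψ y) })

idₕ : ∀ {ℓ} {G : Hypergraph ℓ} → Hom G G
idₕ = hom (λ v → v) (λ e → e) (λ i → i) (λ _ → refl) (λ _ → refl)

V◇ : ∀ {ℓ} → Hypergraph ℓ
V◇ = record { V = ⊤ ; E = ⊥ ; I = ⊥ ; ς = λ () ; ω = λ () }

I◇ : ∀ {ℓ} → Hypergraph ℓ
I◇ = record { V = ⊤ ; E = ⊤ ; I = ⊤ ; ς = λ _ → tt ; ω = λ _ → tt }

Yy : ∀ {ℓ} → Hom {ℓ} V◇ I◇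
Yy = hom (λ _ → tt) (λ ()) (λ ()) (λ ()) (λ ())

r⁻¹ : ∀ {ℓ} (G : Hypergraph ℓ) → Hom G (G □ V◇)
r⁻¹ G = hom (λ v → (v , tt)) (λ e → inj₁ (e , tt)) (λ i → inj₁ (i , tt))
  (λ _ → refl) (λ _ → refl)

[_,_]V : ∀ {ℓ} → Hypergraph ℓ → Hypergraph ℓ → Hypergraph ℓ
[ G , H ]V = record
  { V = Hom G H
  ; E = V G → E H
  ; I = Hom (G □ I◇) H
  ; ς = λ ψ → (ψ ∘ₕ (idₕ □ₕ Yy)) ∘ₕ r⁻¹ G
  ; ω = λ ψ v → Eφ ψ (inj₂ (v , tt))
  }

module _ {ℓ} (G H : Hypergraph ℓ) where
  private
    vV : V (G □ [ G , H ]V) → V H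
    vV (v , φ) = Vφ φ v
    vE : E (G □ [ G , H ]V) → E H
    vE (inj₁ (x , φ)) = Eφ φ x
    vE (inj₂ (x , f)) = f x
    vI : I (G □ [ G , H ]V) → I H
    vI (inj₁ (x , φ)) = Iφ φ x
    vI (inj₂ (x , φ)) = Iφ φ (inj₂ (x , tt))
    vς : ∀ i → ς H (vI i) ≡ vV (ς (G □ [ G , H ]V) i)
    vς (inj₁ (x , hom _ _ _ s _)) = s x
    vς (inj₂ (x , hom _ _ _ s _)) = s (inj₂ (x , tt))
    vω : ∀ i → ω H (vI i) ≡ vE (ω (G □ [ G , H ]V) i)
    vω (inj₁ (x , hom _ _ _ _ o)) = o x
    vω (inj₂ (x , hom _ _ _ _ o)) = o (inj₂ (x , tt))

  vev : Hom (G □ [ G , H ]V) H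
  vev = hom vV vE vI vς vω

module Submission where

-- The exponential is built so that a homomorphism K → [G,H]_V is literally a
-- currying of a homomorphism G □ K → H: a vertex k gives the homomorphism
-- G → H read off the copy G × {k}, an edge e gives the edge function v ↦ φ(2,v,e),
-- and an incidence j gives the homomorphism G □ I◇ → H combining the copy of G
-- over ς j with the incidences (2,v,j).  Currying and evaluation are then
-- mutually inverse, which is existence and uniqueness at once.

open import Defs
open import Data.Product using (Σ; _×_; _,_)
open import Data.Sum using (inj₁; inj₂)
open import Data.Unit.Polymorphic using (tt)
open import Relation.Binary.PropositionalEquality using (_≡_; refl; cong; cong₂; cong-app; sym)
open import Axiom.Extensionality.Propositional using (Extensionality)
open import Axiom.UniquenessOfIdentityProofs.WithK using (uip)

module _ {ℓ} (ext : Extensionality ℓ ℓ) where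

  Hom-≡ : {G H : Hypergraph ℓ} {f g : Hom G H} →
          Vφ f ≡ Vφ g → Eφ f ≡ Eφ g → Iφ f ≡ Iφ g → f ≡ g
  Hom-≡ {f = hom v e i s o} {hom .v .e .i s′ o′} refl refl refl =
    cong₂ (hom v e i) (ext λ x → uip (s x) (s′ x)) (ext λ x → uip (o x) (o′ x))

  module _ (G H K : Hypergraph ℓ) where

    curry : Hom (G □ K) H → Hom K [ G , H ]V
    curry (hom fv fe fi fs fo) = hom slice edgeFun incidenceHom incidenceHom-ς incidenceHom-ω
      where
      slice : V K → Hom G H
      slice k = hom (λ v → fv (v , k)) (λ e → fe (inj₁ (e , k))) (λ i → fi (inj₁ (i , k)))
                    (λ i → fs (inj₁ (i , k))) (λ i → fo (inj₁ (i , k)))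

      edgeFun : E K → V G → E H
      edgeFun e v = fe (inj₂ (v , e))

      incidenceHom : I K → Hom (G □ I◇) H
      incidenceHom j = hom
        (λ { (v , _) → fv (v , ς K j) })
        (λ { (inj₁ (e , _)) → fe (inj₁ (e , ς K j)) ; (inj₂ (v , _)) → fe (inj₂ (v , ω K j)) })
        (λ { (inj₁ (i , _)) → fi (inj₁ (i , ς K j)) ; (inj₂ (v , _)) → fi (inj₂ (v , j)) })
        (λ { (inj₁ (i , _)) → fs (inj₁ (i , ς K j)) ; (inj₂ (v , _)) → fs (inj₂ (v , j)) })
        (λ { (inj₁ (i , _)) → fo (inj₁ (i , ς K j)) ; (inj₂ (v , _)) → fo (inj₂ (v , j)) })

      incidenceHom-ς : ∀ j → ς [ G , H ]V (incidenceHom j) ≡ slice (ς K j)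
      incidenceHom-ς j = Hom-≡ refl refl refl

      incidenceHom-ω : ∀ j → ω [ G , H ]V (incidenceHom j) ≡ edgeFun (ω K j)
      incidenceHom-ω j = refl

    vev∘curry : (φ : Hom (G □ K) H) → vev G H ∘ₕ (idₕ □ₕ curry φ) ≡ φ
    vev∘curry (hom _ _ _ _ _) = Hom-≡
      (ext λ { (v , k) → refl })
      (ext λ { (inj₁ (e , k)) → refl ; (inj₂ (v , e)) → refl })
      (ext λ { (inj₁ (i , k)) → refl ; (inj₂ (v , j)) → refl })

    -- The incidence component is where the commutation laws of ψ are needed:
    -- they pin down ψ j on the copy of G and on the edges (2,v,1).
    curry∘vev : (ψ : Hom K [ G , H ]V) → curry (vev G H ∘ₕ (idₕ □ₕ ψ)) ≡ ψ
    curry∘vev (hom _ _ _ ψς ψω) = sym (Hom-≡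
      (ext λ k → Hom-≡ refl refl refl)
      refl
      (ext λ j → Hom-≡
        (ext λ { (v , tt) → cong-app (cong Vφ (ψς j)) v })
        (ext λ { (inj₁ (e , tt)) → cong-app (cong Eφ (ψς j)) e ; (inj₂ (v , tt)) → cong-app (ψω j) v })
        (ext λ { (inj₁ (i , tt)) → cong-app (cong Iφ (ψς j)) i ; (inj₂ (v , tt)) → refl })))

mainTheorem15 : ∀ {ℓ} → Extensionality ℓ ℓ → (G H K : Hypergraph ℓ) → (φ : Hom (G □ K) H) →
    Σ (Hom K [ G , H ]V) (λ φ̂ →
    ((vev G H ∘ₕ (idₕ □ₕ φ̂)) ≡ φ) × (∀ (ψ : Hom K [ G , H ]V) → (vev G H ∘ₕ (idₕ □ₕ ψ)) ≡ φ → ψ ≡ φ̂))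
mainTheorem15 ext G H K φ =
  curry ext G H K φ , vev∘curry ext G H K φ , uniqueness
  where
  uniqueness : ∀ ψ → vev G H ∘ₕ (idₕ □ₕ ψ) ≡ φ → ψ ≡ curry ext G H K φ
  uniqueness ψ refl = sym (curry∘vev ext G H K ψ)
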